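{- Let $p$ be a prime with $p \equiv 3 \pmod 4$ and let $k \geq 1$. Then $$|N_{p^k}| = \begin{cases} \dfrac{p^k - 1}{p+1}, & k \text{ even},\\[2mm] \dfrac{p^k - p}{p+1}, & k \text{ odd}.\end{cases}$$
   Context: For a positive integer $n$, $\mathbb{Z}_n$ denotes the ring of integers modulo $n$. Define $S_n := \{ m \in \mathbb{Z}_n : m = x^2 + y^2 \text{ for some } x, y \in \mathbb{Z}_n\}$ (zero is allowed as one or both squares) and $N_n := \mathbb{Z}_n \setminus S_n$. For a finite set $A$, $|A|$ is its number of elements. -}

module Defs where

open import Data.Nat using (ℕ; zero; suc; _+_; _*_; _%_; NonZero)
open import Data.Nat.Properties using (_≟_)
open import Data.Fin using (Fin; toℕ)
open import Data.Fin.Properties using (any?)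
open import Data.List using (List; length; filter)
open import Data.List using () renaming (allFin to allFinL)
open import Data.Product using (∃; ∃-syntax; Σ-syntax)
open import Relation.Binary.PropositionalEquality using (_≡_)
open import Relation.Nullary using (Dec; ¬_; ¬?)

-- ℤ_n is modelled by Fin n (residues 0..n-1), with arithmetic reduced mod n.
-- m ∈ S_n  iff  m = x² + y² in ℤ_n for some x, y ∈ ℤ_n.
InS : (n : ℕ) → .{{_ : NonZero n}} → Fin n → Set
InS n m = Σ[ x ∈ Fin n ] Σ[ y ∈ Fin n ] ((toℕ x * toℕ x + toℕ y * toℕ y) % n ≡ toℕ m)

InS? : (n : ℕ) → .{{_ : NonZero n}} → (m : Fin n) → Dec (InS n m)
InS? n m = any? λ x → any? λ y → (toℕ x * toℕ x + toℕ y * toℕ y) % n ≟ toℕ m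

N : (n : ℕ) → .{{_ : NonZero n}} → List (Fin n)
N n = filter (λ m → ¬? (InS? n m)) (allFinL n)

cardN : (n : ℕ) → .{{_ : NonZero n}} → ℕ
cardN n = length (N n)

module Submission where

-- Fermat's little theorem (via the library's
-- binomial theorem) shows that -1 is not a square mod p: p ∣ x² + y² forces p ∣ x and p ∣ y.
-- A pigeonhole argument writes every residue mod p as a sum of two squares, and Hensel
-- lifting extends this to units modulo every power of p.  Together these characterise the
-- non-sums mod p^k recursively (non-sum): m is one iff p ∣ m but p ∤ m/p, or p² ∣ m and
-- m/p² is a non-sum mod p^(k-2).  Counting in blocks of consecutive residues then gives
-- count(k+2) = count(k) + p^k (p - 1), which solves to the closed forms of the theorem.

open import Defs
open import Data.Nat using (ℕ; suc; _+_; _*_; _∸_; _^_; _/_; _%_; _≥_; NonZero)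
open import Data.Nat.Primality using (Prime)
open import Data.Nat.Properties using (m^n≢0)
open import Relation.Binary.PropositionalEquality using (_≡_)
open import Data.Product using (_×_)

open import Level using (0ℓ)
open import Function using (_∘_; id)
open import Data.Empty using (⊥-elim)
open import Data.Bool using (Bool; true; false)
open import Data.Product using (Σ; _,_; proj₁; proj₂)
open import Data.Sum using (inj₁; inj₂)
open import Data.Nat
open import Data.Nat.Properties
open import Data.Nat.Divisibility
open import Data.Nat.DivMod hiding (_mod_)
open import Data.Nat.Primality using (euclidsLemma; ¬prime[1])
open import Data.Nat.Combinatorics using (_C_; nC1≡n; nCn≡1; nCk+nC[k+1]≡[n+1]C[k+1])
open import Data.Nat.Tactic.RingSolver using (solve-∀)
open import Data.Fin as Fin using (Fin; toℕ; fromℕ; fromℕ<; inject₁)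
open import Data.Fin.Properties using (toℕ-fromℕ; toℕ-fromℕ<; fromℕ<-injective; toℕ-inject₁; toℕ<n; pigeonhole)
open import Data.List using (length; filter; tabulate)
open import Algebra.Definitions.RawMonoid +-0-rawMonoid using (sum) renaming (_×_ to _×₊_)
open import Algebra.Definitions.RawMonoid *-1-rawMonoid using () renaming (_×_ to _×*_)
open import Algebra.Properties.Monoid.Sum +-0-monoid using (sum-init-last)
import Algebra.Properties.CommutativeSemiring.Binomial +-*-commutativeSemiring as Binomial
open import Relation.Nullary using (¬_; ¬?; yes; no; does)
open import Relation.Unary as U using (Pred)
open import Relation.Binary.Bundles using (Setoid)
import Relation.Binary.Reasoning.Setoid as SetoidReasoning
open import Relation.Binary.PropositionalEquality
  using (refl; sym; trans; cong; cong₂; subst; subst₂; module ≡-Reasoning)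

-- a ≈ b mod n: a and b differ by a multiple of n, witnessed as a + s·n = b + t·n.
-- Phrased without subtraction, so it is an equivalence on ℕ for every n (even n = 0).
infix 4 _≈_mod_
_≈_mod_ : ℕ → ℕ → ℕ → Set
a ≈ b mod n = Σ ℕ λ s → Σ ℕ λ t → a + s * n ≡ b + t * n

mod-refl : ∀ {a n} → a ≈ a mod n
mod-refl = 0 , 0 , refl

mod-sym : ∀ {a b n} → a ≈ b mod n → b ≈ a mod n
mod-sym (s , t , e) = t , s , sym e

mod-trans : ∀ {a b c n} → a ≈ b mod n → b ≈ c mod n → a ≈ c mod n
mod-trans {a} {b} {c} {n} (s , t , e) (s′ , t′ , e′) = s + s′ , t′ + t , (begin
  a + (s + s′) * n       ≡⟨ shuffle a s s′ n ⟩
  (a + s * n) + s′ * n   ≡⟨ cong (_+ s′ * n) e ⟩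
  (b + t * n) + s′ * n   ≡⟨ swap b t s′ n ⟩
  (b + s′ * n) + t * n   ≡⟨ cong (_+ t * n) e′ ⟩
  (c + t′ * n) + t * n   ≡⟨ shuffle c t′ t n ⟨
  c + (t′ + t) * n       ∎)
  where
  open ≡-Reasoning
  shuffle : ∀ a u v m → a + (u + v) * m ≡ (a + u * m) + v * m
  shuffle = solve-∀
  swap : ∀ a u v m → (a + u * m) + v * m ≡ (a + v * m) + u * m
  swap = solve-∀

mod-setoid : ℕ → Setoid 0ℓ 0ℓ
mod-setoid n = record
  { Carrier       = ℕ
  ; _≈_           = _≈_mod n
  ; isEquivalence = record { refl = mod-refl ; sym = mod-sym ; trans = mod-trans }
  }

module ModReasoning (n : ℕ) = SetoidReasoning (mod-setoid n)

mod-+ : ∀ {a b c d n} → a ≈ b mod n → c ≈ d mod n → a + c ≈ b + d mod n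
mod-+ {a} {b} {c} {d} {n} (s , t , e) (s′ , t′ , e′) = s + s′ , t + t′ , (begin
  a + c + (s + s′) * n         ≡⟨ regroup a c s s′ n ⟩
  (a + s * n) + (c + s′ * n)   ≡⟨ cong₂ _+_ e e′ ⟩
  (b + t * n) + (d + t′ * n)   ≡⟨ regroup b d t t′ n ⟨
  b + d + (t + t′) * n         ∎)
  where
  open ≡-Reasoning
  regroup : ∀ a c u v m → a + c + (u + v) * m ≡ (a + u * m) + (c + v * m)
  regroup = solve-∀

mod-scale : ∀ {a b n} c → a ≈ b mod n → c * a ≈ c * b mod c * n
mod-scale {a} {b} {n} c (s , t , e) = s , t , (begin
  c * a + s * (c * n)   ≡⟨ factor c a s n ⟩
  c * (a + s * n)       ≡⟨ cong (c *_) e ⟩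
  c * (b + t * n)       ≡⟨ factor c b t n ⟨
  c * b + t * (c * n)   ∎)
  where
  open ≡-Reasoning
  factor : ∀ c a u m → c * a + u * (c * m) ≡ c * (a + u * m)
  factor = solve-∀

mod-divisor : ∀ {a b n} m → a ≈ b mod m * n → a ≈ b mod n
mod-divisor {a} {b} {n} m (s , t , e) = s * m , t * m , (begin
  a + s * m * n     ≡⟨ cong (a +_) (*-assoc s m n) ⟩
  a + s * (m * n)   ≡⟨ e ⟩
  b + t * (m * n)   ≡⟨ cong (b +_) (*-assoc t m n) ⟨
  b + t * m * n     ∎)
  where open ≡-Reasoning

mod-*ˡ : ∀ {a b n} c → a ≈ b mod n → c * a ≈ c * b mod n
mod-*ˡ c e = mod-divisor c (mod-scale c e)

mod-* : ∀ {a b c d n} → a ≈ b mod n → c ≈ d mod n → a * c ≈ b * d mod n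
mod-* {a} {b} {c} {d} {n} e e′ =
  mod-trans (subst₂ (_≈_mod n) (*-comm c a) (*-comm c b) (mod-*ˡ c e)) (mod-*ˡ b e′)

mod-unscale : ∀ {a b n} c → .{{NonZero c}} → c * a ≈ c * b mod c * n → a ≈ b mod n
mod-unscale {a} {b} {n} c (s , t , e) = s , t , *-cancelˡ-≡ (a + s * n) (b + t * n) c (begin
  c * (a + s * n)       ≡⟨ factor c a s n ⟩
  c * a + s * (c * n)   ≡⟨ e ⟩
  c * b + t * (c * n)   ≡⟨ factor c b t n ⟨
  c * (b + t * n)       ∎)
  where
  open ≡-Reasoning
  factor : ∀ c a u m → c * (a + u * m) ≡ c * a + u * (c * m)
  factor = solve-∀

mod-+-cancelˡ : ∀ {a b n} c → c + a ≈ c + b mod n → a ≈ b mod n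
mod-+-cancelˡ {a} {b} {n} c (s , t , e) = s , t , +-cancelˡ-≡ c _ _ (begin
  c + (a + s * n)   ≡⟨ +-assoc c a (s * n) ⟨
  c + a + s * n     ≡⟨ e ⟩
  c + b + t * n     ≡⟨ +-assoc c b (t * n) ⟩
  c + (b + t * n)   ∎)
  where open ≡-Reasoning

mod-multiple : ∀ a k n → a + k * n ≈ a mod n
mod-multiple a k n = 0 , k , +-identityʳ _

∣⇒mod-0 : ∀ {a n} → n ∣ a → a ≈ 0 mod n
∣⇒mod-0 {a} (divides q e) = 0 , q , trans (+-identityʳ a) e

∣-resp-mod : ∀ {a b n} → n ∣ a → a ≈ b mod n → n ∣ b
∣-resp-mod {a} {b} {n} n∣a (s , t , e) =
  ∣m+n∣m⇒∣n (subst (n ∣_) (trans e (+-comm b (t * n))) (∣m∣n⇒∣m+n n∣a (n∣m*n s))) (n∣m*n t)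

mod⇒∣∸ : ∀ {a b n} → a ≤ b → a ≈ b mod n → n ∣ b ∸ a
mod⇒∣∸ {a} {b} {n} a≤b (s , t , e) = ∣m+n∣m⇒∣n (divides s tn+diff) (n∣m*n t)
  where
  open ≡-Reasoning
  swap : ∀ d u a → u + d + a ≡ (d + a) + u
  swap = solve-∀
  tn+diff : t * n + (b ∸ a) ≡ s * n
  tn+diff = +-cancelʳ-≡ a _ _ (begin
    t * n + (b ∸ a) + a   ≡⟨ swap (b ∸ a) (t * n) a ⟩
    (b ∸ a + a) + t * n   ≡⟨ cong (_+ t * n) (m∸n+n≡m a≤b) ⟩
    b + t * n             ≡⟨ e ⟨
    a + s * n             ≡⟨ +-comm a (s * n) ⟩
    s * n + a             ∎)

∣∸⇒mod : ∀ {a b n} → a ≤ b → n ∣ b ∸ a → a ≈ b mod n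
∣∸⇒mod {a} {b} {n} a≤b (divides q e) = q , 0 , (begin
  a + q * n     ≡⟨ cong (a +_) e ⟨
  a + (b ∸ a)   ≡⟨ m+[n∸m]≡n a≤b ⟩
  b             ≡⟨ +-identityʳ b ⟨
  b + 0 * n     ∎)
  where open ≡-Reasoning

mod⇒%≡ : ∀ {a b n} .{{_ : NonZero n}} → a ≈ b mod n → a % n ≡ b % n
mod⇒%≡ {a} {b} {n} (s , t , e) = begin
  a % n             ≡⟨ [m+kn]%n≡m%n a s n ⟨
  (a + s * n) % n   ≡⟨ cong (_% n) e ⟩
  (b + t * n) % n   ≡⟨ [m+kn]%n≡m%n b t n ⟩
  b % n             ∎
  where open ≡-Reasoning

%-mod : ∀ a n .{{_ : NonZero n}} → a % n ≈ a mod n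
%-mod a n = a / n , 0 , trans (sym (m≡m%n+[m/n]*n a n)) (sym (+-identityʳ a))

%≡⇒mod : ∀ {a b n} .{{_ : NonZero n}} → a % n ≡ b % n → a ≈ b mod n
%≡⇒mod {a} {b} {n} eq = mod-trans (mod-sym (%-mod a n)) (subst (_≈ b mod n) (sym eq) (%-mod b n))

mod-one : ∀ a b → a ≈ b mod 1
mod-one a b = b , a , trans (cong (a +_) (*-identityʳ b)) (trans (+-comm a b) (cong (b +_) (sym (*-identityʳ a))))

C-absorption : ∀ n k → suc k * (suc n C suc k) ≡ suc n * (n C k)
C-absorption zero    zero    = refl
C-absorption zero    (suc k) = *-zeroʳ (suc (suc k))
C-absorption (suc n) zero    = begin
  1 * (suc (suc n) C 1)   ≡⟨ *-identityˡ _ ⟩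
  suc (suc n) C 1         ≡⟨ nC1≡n (suc (suc n)) ⟩
  suc (suc n)             ≡⟨ *-identityʳ _ ⟨
  suc (suc n) * 1         ∎
  where open ≡-Reasoning
C-absorption (suc n) (suc j) = begin
  suc (suc j) * (suc (suc n) C suc (suc j))   ≡⟨ cong (suc (suc j) *_) (pascal (suc n) (suc j)) ⟨
  suc (suc j) * (b + c)                       ≡⟨ expand j b c ⟩
  suc j * b + b + suc (suc j) * c             ≡⟨ cong₂ (λ u v → u + b + v) (C-absorption n j) (C-absorption n (suc j)) ⟩
  suc n * a₀ + b + suc n * a₁                 ≡⟨ cong (λ u → suc n * a₀ + u + suc n * a₁) (pascal n j) ⟨
  suc n * a₀ + (a₀ + a₁) + suc n * a₁         ≡⟨ collect n a₀ a₁ ⟩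
  suc (suc n) * (a₀ + a₁)                     ≡⟨ cong (suc (suc n) *_) (pascal n j) ⟩
  suc (suc n) * b                             ∎
  where
  open ≡-Reasoning
  pascal = nCk+nC[k+1]≡[n+1]C[k+1]
  a₀ = n C j
  a₁ = n C suc j
  b  = suc n C suc j
  c  = suc n C suc (suc j)
  expand : ∀ j b c → suc (suc j) * (b + c) ≡ suc j * b + b + suc (suc j) * c
  expand = solve-∀
  collect : ∀ n a₀ a₁ → suc n * a₀ + (a₀ + a₁) + suc n * a₁ ≡ suc (suc n) * (a₀ + a₁)
  collect = solve-∀

×₊≡* : ∀ k y → k ×₊ y ≡ k * y
×₊≡* zero    y = refl
×₊≡* (suc k) y = cong (y +_) (×₊≡* k y)

×*≡^ : ∀ n x → n ×* x ≡ x ^ n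
×*≡^ zero    x = refl
×*≡^ (suc n) x = cong (x *_) (×*≡^ n x)

binomialTerm≡ : ∀ x n (k : Fin (suc n)) → Binomial.binomialTerm x 1 n k ≡ (n C toℕ k) * (x ^ toℕ k * 1 ^ (n ∸ toℕ k))
binomialTerm≡ x n k = trans (×₊≡* (n C toℕ k) _)
  (cong ((n C toℕ k) *_) (cong₂ _*_ (×*≡^ (toℕ k) x) (×*≡^ (n ∸ toℕ k) 1)))

binomialTheorem : ∀ x n → (x + 1) ^ n ≡ sum (Binomial.binomialTerm x 1 n)
binomialTheorem x n = trans (sym (×*≡^ n (x + 1))) (Binomial.theorem n x 1)

binomialTerm-first : ∀ x n → Binomial.binomialTerm x 1 n Fin.zero ≡ 1
binomialTerm-first x n = trans (binomialTerm≡ x n Fin.zero) (cong (λ u → 1 * (1 * u)) (^-zeroˡ n))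

binomialTerm-last : ∀ x n → Binomial.binomialTerm x 1 n (fromℕ n) ≡ x ^ n
binomialTerm-last x n = begin
  Binomial.binomialTerm x 1 n (fromℕ n)
    ≡⟨ binomialTerm≡ x n (fromℕ n) ⟩
  (n C toℕ (fromℕ n)) * (x ^ toℕ (fromℕ n) * 1 ^ (n ∸ toℕ (fromℕ n)))
    ≡⟨ cong (λ j → (n C j) * (x ^ j * 1 ^ (n ∸ j))) (toℕ-fromℕ n) ⟩
  (n C n) * (x ^ n * 1 ^ (n ∸ n))
    ≡⟨ cong₂ (λ c j → c * (x ^ n * 1 ^ j)) (nCn≡1 n) (n∸n≡0 n) ⟩
  1 * (x ^ n * 1)
    ≡⟨ trans (*-identityˡ _) (*-identityʳ _) ⟩
  x ^ n
    ∎
  where open ≡-Reasoning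

∣-sum : ∀ {d n} (f : Fin n → ℕ) → (∀ i → d ∣ f i) → d ∣ sum f
∣-sum {n = zero}  f d∣f = _ ∣0
∣-sum {n = suc n} f d∣f = ∣m∣n⇒∣m+n (d∣f Fin.zero) (∣-sum (λ i → f (Fin.suc i)) (λ i → d∣f (Fin.suc i)))

-- a + b divides every odd power sum a^(2i+1) + b^(2i+1), via the recurrence
-- a^(m+2) + b^(m+2) + ab·(a^m + b^m) = (a + b)(a^(m+1) + b^(m+1)).
odd-power-sum : ∀ a b i → a + b ∣ a ^ suc (i + i) + b ^ suc (i + i)
odd-power-sum a b zero    = subst (a + b ∣_) (sym (cong₂ _+_ (*-identityʳ a) (*-identityʳ b))) ∣-refl
odd-power-sum a b (suc i) = subst (λ m → a + b ∣ a ^ suc m + b ^ suc m) (sym (+-suc (suc i) i))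
  (∣m+n∣m⇒∣n (subst (a + b ∣_) (recurrence a b (a ^ suc (i + i)) (b ^ suc (i + i))) (m∣m*n _))
              (∣-trans (odd-power-sum a b i) (n∣m*n (a * b))))
  where
  recurrence : ∀ a b u v → (a + b) * (a * u + b * v) ≡ a * b * (u + v) + (a * (a * u) + b * (b * v))
  recurrence = solve-∀

^-double : ∀ x m → x ^ (m + m) ≡ (x * x) ^ m
^-double x zero    = refl
^-double x (suc m) = begin
  x * x ^ (m + suc m)       ≡⟨ cong (λ e → x * x ^ e) (+-suc m m) ⟩
  x * (x * x ^ (m + m))     ≡⟨ cong (λ u → x * (x * u)) (^-double x m) ⟩
  x * (x * (x * x) ^ m)     ≡⟨ *-assoc x x _ ⟨
  (x * x) ^ suc m           ∎
  where open ≡-Reasoning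

square-difference : ∀ {a b} → a ≤ b → b * b ∸ a * a ≡ (b ∸ a) * (b + a)
square-difference {a} {b} a≤b = begin
  b * b ∸ a * a                       ≡⟨ cong (λ c → c * c ∸ a * a) (m+[n∸m]≡n a≤b) ⟨
  (a + d) * (a + d) ∸ a * a           ≡⟨ cong (_∸ a * a) (expand a d) ⟩
  a * a + d * ((a + d) + a) ∸ a * a   ≡⟨ m+n∸m≡n (a * a) _ ⟩
  d * ((a + d) + a)                   ≡⟨ cong (λ c → d * (c + a)) (m+[n∸m]≡n a≤b) ⟩
  d * (b + a)                         ∎
  where
  open ≡-Reasoning
  d = b ∸ a
  expand : ∀ a d → (a + d) * (a + d) ≡ a * a + d * ((a + d) + a)
  expand = solve-∀

exact-quotient : ∀ q d r .{{_ : NonZero d}} → (q * d + r ∸ r) / d ≡ q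
exact-quotient q d r = trans (cong (_/ d) (m+n∸n≡m (q * d) r)) (m*n/n≡m q d)

even⇒double : ∀ k → k % 2 ≡ 0 → k ≡ k / 2 + k / 2
even⇒double k k%2≡0 = trans (m≡m%n+[m/n]*n k 2) (trans (cong (_+ k / 2 * 2) k%2≡0) (double (k / 2)))
  where
  double : ∀ i → 0 + i * 2 ≡ i + i
  double = solve-∀

odd⇒double+1 : ∀ k → k % 2 ≡ 1 → k ≡ suc (k / 2 + k / 2)
odd⇒double+1 k k%2≡1 = trans (m≡m%n+[m/n]*n k 2) (trans (cong (_+ k / 2 * 2) k%2≡1) (double+1 (k / 2)))
  where
  double+1 : ∀ i → 1 + i * 2 ≡ suc (i + i)
  double+1 = solve-∀

SumOfTwoSquares : ℕ → ℕ → Set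
SumOfTwoSquares n m = Σ ℕ λ x → Σ ℕ λ y → x * x + y * y ≈ m mod n

InS⇒sum : ∀ n .{{_ : NonZero n}} (i : Fin n) → InS n i → SumOfTwoSquares n (toℕ i)
InS⇒sum n i (x , y , eq) = toℕ x , toℕ y , subst (_ ≈_mod n) eq (mod-sym (%-mod _ n))

sum⇒InS : ∀ n .{{_ : NonZero n}} (i : Fin n) → SumOfTwoSquares n (toℕ i) → InS n i
sum⇒InS n i (x , y , rep) = reduce x , reduce y , (begin
  (toℕ (reduce x) * toℕ (reduce x) + toℕ (reduce y) * toℕ (reduce y)) % n
    ≡⟨ cong₂ (λ u v → (u * u + v * v) % n) (toℕ-fromℕ< (m%n<n x n)) (toℕ-fromℕ< (m%n<n y n)) ⟩
  (x % n * (x % n) + y % n * (y % n)) % n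
    ≡⟨ mod⇒%≡ (mod-trans (mod-+ (mod-* (%-mod x n) (%-mod x n)) (mod-* (%-mod y n) (%-mod y n))) rep) ⟩
  toℕ i % n
    ≡⟨ m<n⇒m%n≡m (toℕ<n i) ⟩
  toℕ i
    ∎)
  where
  open ≡-Reasoning
  reduce : ℕ → Fin n
  reduce z = fromℕ< (m%n<n z n)

sumTo : ℕ → (ℕ → ℕ) → ℕ
sumTo zero    f = 0
sumTo (suc n) f = f 0 + sumTo n (f ∘ suc)

sumTo-cong : ∀ n {f g} → (∀ i → i < n → f i ≡ g i) → sumTo n f ≡ sumTo n g
sumTo-cong zero    f≡g = refl
sumTo-cong (suc n) f≡g = cong₂ _+_ (f≡g 0 z<s) (sumTo-cong n (λ i i<n → f≡g (suc i) (s<s i<n)))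

sumTo-const : ∀ n c → sumTo n (λ _ → c) ≡ n * c
sumTo-const zero    c = refl
sumTo-const (suc n) c = cong (c +_) (sumTo-const n c)

sumTo-+ : ∀ n f g → sumTo n (λ i → f i + g i) ≡ sumTo n f + sumTo n g
sumTo-+ zero    f g = refl
sumTo-+ (suc n) f g = trans (cong (f 0 + g 0 +_) (sumTo-+ n (f ∘ suc) (g ∘ suc)))
                            (+-+-interchange (f 0) (g 0) _ _)
  where
  +-+-interchange : ∀ a b c d → a + b + (c + d) ≡ (a + c) + (b + d)
  +-+-interchange = solve-∀

sumTo-split : ∀ m n f → sumTo (m + n) f ≡ sumTo m f + sumTo n (λ i → f (m + i))
sumTo-split zero    n f = refl
sumTo-split (suc m) n f = trans (cong (f 0 +_) (sumTo-split m n (f ∘ suc))) (sym (+-assoc (f 0) _ _))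

sumTo-blocks : ∀ N d f → sumTo (N * d) f ≡ sumTo N (λ a → sumTo d (λ r → f (a * d + r)))
sumTo-blocks zero    d f = refl
sumTo-blocks (suc N) d f = begin
  sumTo (d + N * d) f                                            ≡⟨ sumTo-split d (N * d) f ⟩
  sumTo d f + sumTo (N * d) (λ i → f (d + i))                    ≡⟨ cong (sumTo d f +_) (sumTo-blocks N d (λ i → f (d + i))) ⟩
  sumTo d f + sumTo N (λ a → sumTo d (λ r → f (d + (a * d + r))))
    ≡⟨ cong (sumTo d f +_) (sumTo-cong N (λ a _ → sumTo-cong d (λ r _ → cong f (+-assoc d (a * d) r)))) ⟨
  sumTo d f + sumTo N (λ a → sumTo d (λ r → f (d + a * d + r)))  ∎
  where open ≡-Reasoning

indicator : Bool → ℕ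
indicator true  = 1
indicator false = 0

length-filter-tabulate : ∀ {A : Set} {P : Pred A 0ℓ} (P? : U.Decidable P) n (f : Fin n → A) (F : ℕ → Bool) →
  (∀ i → does (P? (f i)) ≡ F (toℕ i)) → length (filter P? (tabulate f)) ≡ sumTo n (indicator ∘ F)
length-filter-tabulate P? zero    f F agree = refl
length-filter-tabulate P? (suc n) f F agree with P? (f Fin.zero) | F 0 | agree Fin.zero
... | yes _ | true  | refl = cong suc (length-filter-tabulate P? n (f ∘ Fin.suc) (F ∘ suc) (agree ∘ Fin.suc))
... | no  _ | false | refl = length-filter-tabulate P? n (f ∘ Fin.suc) (F ∘ suc) (agree ∘ Fin.suc)

module _ (p-1 : ℕ) (p-prime : Prime (suc p-1)) where

  p : ℕ
  p = suc p-1

  p∤small : ∀ {n} → 0 < n → n < p → ¬ p ∣ n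
  p∤small {suc n} _ n<p p∣n = <⇒≱ n<p (∣⇒≤ p∣n)

  -- p divides the inner binomial coefficients C(p, k), 0 < k < p, by absorption.
  p∣C : ∀ k → suc k < p → p ∣ p C suc k
  p∣C k k<p with euclidsLemma (suc k) (p C suc k) p-prime
                   (divides (p-1 C k) (trans (C-absorption p-1 k) (*-comm p _)))
  ... | inj₁ p∣k = ⊥-elim (p∤small z<s k<p p∣k)
  ... | inj₂ p∣C = p∣C

  -- The "freshman's dream": (x + 1)^p ≡ x^p + 1, since all inner binomial terms vanish mod p.
  frobenius : ∀ x → (x + 1) ^ p ≈ x ^ p + 1 mod p
  frobenius x = begin
    (x + 1) ^ p                                   ≡⟨ binomialTheorem x p ⟩
    T Fin.zero + sum (λ i → T (Fin.suc i))        ≡⟨ cong (T Fin.zero +_) (sum-init-last (λ i → T (Fin.suc i))) ⟩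
    T Fin.zero + (sum inner + T (fromℕ p))        ≡⟨ cong₂ (λ u v → u + (sum inner + v)) (binomialTerm-first x p) (binomialTerm-last x p) ⟩
    1 + (sum inner + x ^ p)                       ≈⟨ mod-+ (mod-refl {1}) (mod-+ (∣⇒mod-0 (∣-sum inner p∣inner)) mod-refl) ⟩
    1 + x ^ p                                     ≡⟨ +-comm 1 (x ^ p) ⟩
    x ^ p + 1                                     ∎
    where
    open ModReasoning p
    T = Binomial.binomialTerm x 1 p
    inner : Fin p-1 → ℕ
    inner i = T (Fin.suc (inject₁ i))
    p∣inner : ∀ i → p ∣ inner i
    p∣inner i = subst (p ∣_) (sym (binomialTerm≡ x p (Fin.suc (inject₁ i))))
      (∣-trans (p∣C (toℕ (inject₁ i)) (s<s (subst (_< p-1) (sym (toℕ-inject₁ i)) (toℕ<n i))))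
               (m∣m*n _))

  -- Fermat's little theorem, by induction on x using the freshman's dream.
  fermat : ∀ x → x ^ p ≈ x mod p
  fermat zero    = mod-refl
  fermat (suc x) = begin
    suc x ^ p       ≡⟨ cong (_^ p) (+-comm 1 x) ⟩
    (x + 1) ^ p     ≈⟨ frobenius x ⟩
    x ^ p + 1       ≈⟨ mod-+ (fermat x) mod-refl ⟩
    x + 1           ≡⟨ +-comm x 1 ⟩
    suc x           ∎
    where open ModReasoning p

  -- A factor prime to p can be cancelled from a congruence mod p (Euclid's lemma),
  -- first when a ≤ b, where the congruence says that p divides c·(b ∸ a).
  cancel-unit-≤ : ∀ c {a b} → ¬ p ∣ c → a ≤ b → c * a ≈ c * b mod p → a ≈ b mod p
  cancel-unit-≤ c {a} {b} p∤c a≤b ca≈cb with euclidsLemma c (b ∸ a) p-prime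
    (subst (p ∣_) (sym (*-distribˡ-∸ c b a)) (mod⇒∣∸ (*-monoʳ-≤ c a≤b) ca≈cb))
  ... | inj₁ p∣c   = ⊥-elim (p∤c p∣c)
  ... | inj₂ p∣b∸a = ∣∸⇒mod a≤b p∣b∸a

  cancel-unit : ∀ c {a b} → ¬ p ∣ c → c * a ≈ c * b mod p → a ≈ b mod p
  cancel-unit c {a} {b} p∤c ca≈cb with ≤-total a b
  ... | inj₁ a≤b = cancel-unit-≤ c p∤c a≤b ca≈cb
  ... | inj₂ b≤a = mod-sym (cancel-unit-≤ c p∤c b≤a (mod-sym ca≈cb))

  fermat-unit : ∀ x → ¬ p ∣ x → x ^ p-1 ≈ 1 mod p
  fermat-unit x p∤x = cancel-unit x p∤x (subst (x ^ p ≈_mod p) (sym (*-identityʳ x)) (fermat x))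

  -- A unit c has an inverse mod p, namely c^(p-2), by Fermat.
  unit-inverse : ∀ c → ¬ p ∣ c → Σ ℕ λ w → c * w ≈ 1 mod p
  unit-inverse c p∤c = c ^ pred p-1 , subst (λ e → c ^ e ≈ 1 mod p) p-1≡1+[p-2] (fermat-unit c p∤c)
    where
    p-1≡1+[p-2] : p-1 ≡ suc (pred p-1)
    p-1≡1+[p-2] = sym (suc-pred p-1 {{≢-nonZero λ { refl → ¬prime[1] p-prime }}})

  p∣square⇒p∣ : ∀ x → p ∣ x * x → p ∣ x
  p∣square⇒p∣ x p∣x² with euclidsLemma x x p-prime p∣x²
  ... | inj₁ p∣x = p∣x
  ... | inj₂ p∣x = p∣x

  -- Residues 0 ≤ a < b with a + b < p have distinct squares mod p,
  -- since b² - a² = (b - a)(b + a) with both factors strictly between 0 and p.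
  squares-distinct : ∀ {a b} → a < b → a + b < p → ¬ (a * a ≈ b * b mod p)
  squares-distinct {a} {b} a<b a+b<p a²≈b² with euclidsLemma (b ∸ a) (b + a) p-prime p∣diff
    where
    a≤b = <⇒≤ a<b
    p∣diff : p ∣ (b ∸ a) * (b + a)
    p∣diff = subst (p ∣_) (square-difference a≤b) (mod⇒∣∸ (*-mono-≤ a≤b a≤b) a²≈b²)
  ... | inj₁ p∣b∸a = p∤small (m<n⇒0<n∸m a<b) (≤-<-trans (m∸n≤m b a) (≤-<-trans (m≤n+m b a) a+b<p)) p∣b∸a
  ... | inj₂ p∣b+a = p∤small (<-≤-trans (m<n⇒0<n∸m a<b) (≤-trans (m∸n≤m b a) (m≤m+n b a)))
                             (subst (_< p) (+-comm a b) a+b<p) p∣b+a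

  module _ (p%4≡3 : p % 4 ≡ 3) where

    -- Write p = 4j + 3, so that p - 1 = 2(2j + 1) with 2j + 1 odd.
    j : ℕ
    j = p / 4

    p≡3+4j : p ≡ 3 + j * 4
    p≡3+4j = trans (m≡m%n+[m/n]*n p 4) (cong (_+ j * 4) p%4≡3)

    p-1≡2[2j+1] : p-1 ≡ suc (j + j) + suc (j + j)
    p-1≡2[2j+1] = trans (suc-injective p≡3+4j) (halve j)
      where
      halve : ∀ j → 2 + j * 4 ≡ suc (j + j) + suc (j + j)
      halve = solve-∀

    2<p : 2 < p
    2<p = subst (2 <_) (sym p≡3+4j) (s≤s (s≤s (s≤s z≤n)))

    -- -1 is not a square mod p: if p ∣ x² + y² then p ∣ x (and p ∣ y).  Otherwise
    -- x^(p-1) + y^(p-1) = (x²)^(2j+1) + (y²)^(2j+1) is divisible by x² + y², hence by p,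
    -- while Fermat makes it ≡ 1 + 1 = 2 mod p.
    p∣sum-of-squares : ∀ x y → p ∣ x * x + y * y → p ∣ x
    p∣sum-of-squares x y p∣x²+y² with p ∣? x
    ... | yes p∣x = p∣x
    ... | no  p∤x = ⊥-elim (p∤small {2} (s≤s z≤n) 2<p p∣2)
      where
      p∤y : ¬ p ∣ y
      p∤y p∣y = p∤x (p∣square⇒p∣ x (∣m+n∣m⇒∣n (subst (p ∣_) (+-comm (x * x) (y * y)) p∣x²+y²)
                                              (∣-trans p∣y (m∣m*n y))))
      power-of-square : ∀ z → (z * z) ^ suc (j + j) ≡ z ^ p-1
      power-of-square z = trans (sym (^-double z (suc (j + j)))) (cong (z ^_) (sym p-1≡2[2j+1]))
      p∣2 : p ∣ 2
      p∣2 = ∣-resp-mod (subst (p ∣_) (cong₂ _+_ (power-of-square x) (power-of-square y))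
                                    (∣-trans p∣x²+y² (odd-power-sum (x * x) (y * y) j)))
                       (mod-+ (fermat-unit x p∤x) (fermat-unit y p∤y))

    -- h = (p + 1)/2 = 2j + 2 candidates of each kind in the pigeonhole argument below.
    h : ℕ
    h = suc (suc (j + j))

    1+p≡h+h : suc p ≡ h + h
    1+p≡h+h = trans (cong suc p≡3+4j) (halve j)
      where
      halve : ∀ j → suc (3 + j * 4) ≡ suc (suc (j + j)) + suc (suc (j + j))
      halve = solve-∀

    below-h : ∀ {a b} → a < b → b < h → a + b < p
    below-h {a} {b} a<b b<h = begin-strict
      a + b                       <⟨ +-monoˡ-< b a<b ⟩
      b + b                       ≤⟨ +-mono-≤ (s≤s⁻¹ b<h) (s≤s⁻¹ b<h) ⟩
      suc (j + j) + suc (j + j)   ≡⟨ p-1≡2[2j+1] ⟨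
      p-1                         <⟨ n<1+n p-1 ⟩
      p                           ∎
      where open ≤-Reasoning

    -- The candidates i² (i < h) and u - (i-h)² ≡ u + (p-1)(i-h)² (h ≤ i ≤ p).
    candidate : ℕ → ℕ → ℕ
    candidate u i with i <? h
    ... | yes _ = i * i
    ... | no  _ = u + p-1 * ((i ∸ h) * (i ∸ h))

    -- Two congruent candidates i < i′ must be of different kinds (squares below h are
    -- pairwise incongruent, and so are the u - c²), and then i² + (i′-h)² ≡ u.
    candidates-collide : ∀ u {a b} → a < b → b ≤ p → candidate u a ≈ candidate u b mod p →
                         SumOfTwoSquares p u
    candidates-collide u {a} {b} a<b b≤p same with a <? h | b <? h
    ... | yes _   | yes b<h = ⊥-elim (squares-distinct a<b (below-h a<b b<h) same)
    ... | no  a≮h | yes b<h = ⊥-elim (a≮h (<-trans a<b b<h))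
    ... | yes _   | no  _   = a , c , (begin
      a * a + c * c                  ≈⟨ mod-+ same mod-refl ⟩
      u + p-1 * (c * c) + c * c      ≡⟨ collect u p-1 (c * c) ⟩
      u + c * c * p                  ≈⟨ mod-multiple u (c * c) p ⟩
      u                              ∎)
      where
      open ModReasoning p
      c = b ∸ h
      collect : ∀ u n x → u + n * x + x ≡ u + x * suc n
      collect = solve-∀
    ... | no  a≮h | no  _   = ⊥-elim (squares-distinct a′<b′ (below-h a′<b′ b′<h)
                                (cancel-unit p-1 p∤p-1 (mod-+-cancelˡ u same)))
      where
      a′<b′ : a ∸ h < b ∸ h
      a′<b′ = ∸-monoˡ-< a<b (≮⇒≥ a≮h)
      b′<h : b ∸ h < h
      b′<h = m<n+o⇒m∸n<o b h (subst (b <_) 1+p≡h+h (s≤s b≤p))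
      p∤p-1 : ¬ p ∣ p-1
      p∤p-1 = p∤small (subst (0 <_) (sym p-1≡2[2j+1]) z<s) (n<1+n p-1)

    -- Every residue is a sum of two squares mod p: the p + 1 candidates cannot all
    -- be distinct mod p (pigeonhole).
    two-squares-mod-p : ∀ u → SumOfTwoSquares p u
    two-squares-mod-p u with pigeonhole (n<1+n p) residue
      where
      residue : Fin (suc p) → Fin p
      residue i = fromℕ< (m%n<n (candidate u (toℕ i)) p)
    ... | i , i′ , i<i′ , same-residue = candidates-collide u i<i′ (s≤s⁻¹ (toℕ<n i′))
      (%≡⇒mod (fromℕ<-injective (candidate u (toℕ i) % p) (candidate u (toℕ i′) % p)
                                (m%n<n (candidate u (toℕ i)) p) (m%n<n (candidate u (toℕ i′)) p) same-residue))

    unit-first : ∀ {u} → ¬ p ∣ u → SumOfTwoSquares p u →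
                 Σ ℕ λ x → Σ ℕ λ y → ¬ p ∣ x × x * x + y * y ≈ u mod p
    unit-first {u} p∤u (x , y , rep) with p ∣? x | p ∣? y
    ... | no  p∤x | _       = x , y , p∤x , rep
    ... | yes _   | no  p∤y = y , x , p∤y , subst (_≈ u mod p) (+-comm (x * x) (y * y)) rep
    ... | yes p∣x | yes p∣y = ⊥-elim (p∤u (∣-resp-mod p∣x²+y² rep))
      where
      p∣x²+y² : p ∣ x * x + y * y
      p∣x²+y² = ∣m∣n⇒∣m+n (∣-trans p∣x (m∣m*n x)) (∣-trans p∣y (m∣m*n y))

    -- Hensel lifting: if a² + b² ≡ u mod q = p^(e+1) with p ∤ a, then a′ = a + t·q satisfies
    -- a′² + b² ≡ a² + b² + 2at·q mod p·q; taking t = w·Y, where w inverts 2a mod p and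
    -- Y ≡ (u - a² - b²)/q mod p, makes the right-hand side ≡ u.
    hensel-step : ∀ e {a b u} → ¬ p ∣ a → a * a + b * b ≈ u mod p ^ suc e →
                  Σ ℕ λ a′ → ¬ p ∣ a′ × a′ * a′ + b * b ≈ u mod p ^ suc (suc e)
    hensel-step e {a} {b} {u} p∤a (s , c , rep) = a′ , p∤a′ , lifted
      where
      q = p ^ suc e
      p∤2a : ¬ p ∣ 2 * a
      p∤2a p∣2a with euclidsLemma 2 a p-prime p∣2a
      ... | inj₁ p∣2 = p∤small {2} (s≤s z≤n) 2<p p∣2
      ... | inj₂ p∣a = p∤a p∣a
      inverse = unit-inverse (2 * a) p∤2a
      w = proj₁ inverse
      -- The representation reads a² + b² + s·q = u + c·q, so Y = s + (p-1)·c ≡ c - s mod p.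
      Y = s + p-1 * c
      a′ = a + w * Y * q
      p∤a′ : ¬ p ∣ a′
      p∤a′ p∣a′ = p∤a (∣m+n∣m⇒∣n (subst (p ∣_) (+-comm a (w * Y * q)) p∣a′)
                                  (∣-trans (m∣m*n (p ^ e)) (n∣m*n (w * Y))))
      2awY≈Y : 2 * a * w * Y ≈ Y mod p
      2awY≈Y = subst (2 * a * w * Y ≈_mod p) (*-identityˡ Y)
                     (mod-* (proj₂ inverse) (mod-refl {Y}))
      expand : ∀ a b w Y P pe → (a + w * Y * (P * pe)) * (a + w * Y * (P * pe)) + b * b
               ≡ (a * a + b * b) + P * pe * (2 * a * w * Y) + w * Y * (w * Y) * pe * (P * (P * pe))
      expand = solve-∀
      regroup : ∀ x s n c q → x + q * (s + n * c) ≡ (x + s * q) + n * c * q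
      regroup = solve-∀
      collect : ∀ u c q n → u + c * q + n * c * q ≡ u + c * (suc n * q)
      collect = solve-∀
      lifted : a′ * a′ + b * b ≈ u mod p * q
      lifted = begin
        a′ * a′ + b * b                                        ≡⟨ expand a b w Y p (p ^ e) ⟩
        (a * a + b * b) + q * (2 * a * w * Y) + w * Y * (w * Y) * p ^ e * (p * q)
                                                               ≈⟨ mod-multiple _ (w * Y * (w * Y) * p ^ e) (p * q) ⟩
        (a * a + b * b) + q * (2 * a * w * Y)                  ≈⟨ mod-+ mod-refl
                                                                    (subst (q * (2 * a * w * Y) ≈ q * Y mod_) (*-comm q p) (mod-scale q 2awY≈Y)) ⟩
        (a * a + b * b) + q * Y                                ≡⟨ regroup (a * a + b * b) s p-1 c q ⟩
        (a * a + b * b + s * q) + p-1 * c * q                  ≡⟨ cong (_+ p-1 * c * q) rep ⟩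
        u + c * q + p-1 * c * q                                ≡⟨ collect u c q p-1 ⟩
        u + c * (p * q)                                        ≈⟨ mod-multiple u c (p * q) ⟩
        u                                                      ∎
        where open ModReasoning (p * q)

    two-squares-unit-lift : ∀ e u → ¬ p ∣ u → Σ ℕ λ x → Σ ℕ λ y → ¬ p ∣ x × x * x + y * y ≈ u mod p ^ suc e
    two-squares-unit-lift zero u p∤u =
      let x , y , p∤x , rep = unit-first p∤u (two-squares-mod-p u)
      in  x , y , p∤x , subst (x * x + y * y ≈ u mod_) (sym (*-identityʳ p)) rep
    two-squares-unit-lift (suc e) u p∤u =
      let x  , y , p∤x  , rep  = two-squares-unit-lift e u p∤u
          x′ ,     p∤x′ , rep′ = hensel-step e {x} {y} p∤x rep
      in  x′ , y , p∤x′ , rep′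

    unit-is-two-squares : ∀ k u → ¬ p ∣ u → SumOfTwoSquares (p ^ k) u
    unit-is-two-squares zero    u p∤u = 0 , 0 , mod-one 0 u
    unit-is-two-squares (suc e) u p∤u =
      let x , y , _ , rep = two-squares-unit-lift e u p∤u in x , y , rep

    -- non-sum k m decides whether m fails to be a sum of two squares mod p^k: this happens
    -- iff p^k ∤ m and p occurs in m to an odd power; factors p² are stripped recursively.
    non-sum : ℕ → ℕ → Bool
    non-sum zero          m = false
    non-sum (suc zero)    m = false
    non-sum (suc (suc k)) m with p ∣? m | p ∣? (m / p)
    ... | no  _ | _     = false
    ... | yes _ | no  _ = true
    ... | yes _ | yes _ = non-sum k (m / p / p)

    descend : ∀ k {m} → p ∣ m → SumOfTwoSquares (p * (p * p ^ k)) m →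
              Σ ℕ λ x₁ → Σ ℕ λ y₁ → p * (p * (x₁ * x₁ + y₁ * y₁)) ≈ m mod p * (p * p ^ k)
    descend k {m} p∣m (x , y , rep)
      with p∣sum-of-squares x y p∣x²+y² | p∣sum-of-squares y x (subst (p ∣_) (+-comm (x * x) (y * y)) p∣x²+y²)
      where
      p∣x²+y² : p ∣ x * x + y * y
      p∣x²+y² = ∣-resp-mod p∣m (mod-sym (mod-divisor (p * p ^ k) (subst (x * x + y * y ≈ m mod_) (*-comm p (p * p ^ k)) rep)))
    ... | divides x₁ refl | divides y₁ refl = x₁ , y₁ , subst (_≈ m mod p * (p * p ^ k)) (factor x₁ y₁ p) rep
      where
      factor : ∀ a b p → a * p * (a * p) + b * p * (b * p) ≡ p * (p * (a * a + b * b))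
      factor = solve-∀

    m≡p²[m/p/p] : ∀ {m} → p ∣ m → p ∣ m / p → m ≡ p * (p * (m / p / p))
    m≡p²[m/p/p] {m} p∣m p∣m/p = begin
      m                     ≡⟨ m/n*n≡m p∣m ⟨
      m / p * p             ≡⟨ cong (_* p) (m/n*n≡m p∣m/p) ⟨
      m / p / p * p * p     ≡⟨ rotate (m / p / p) p ⟩
      p * (p * (m / p / p)) ∎
      where
      open ≡-Reasoning
      rotate : ∀ a p → a * p * p ≡ p * (p * a)
      rotate = solve-∀

    -- If non-sum k m holds then m is not a sum of two squares mod p^k: a representation of
    -- m with p ∣ m descends to one of m/p² mod p^(k-2), or forces p² ∣ m.
    non-sum⇒¬sum : ∀ k m → non-sum k m ≡ true → ¬ SumOfTwoSquares (p ^ k) m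
    non-sum⇒¬sum zero          m ()
    non-sum⇒¬sum (suc zero)    m ()
    non-sum⇒¬sum (suc (suc k)) m ns (x , y , rep) with p ∣? m | p ∣? (m / p)
    non-sum⇒¬sum (suc (suc k)) m () _ | no _ | _
    ... | yes p∣m | yes p∣m/p with descend k p∣m (x , y , rep)
    ...   | x₁ , y₁ , rep′ = non-sum⇒¬sum k (m / p / p) ns
      (x₁ , y₁ , mod-unscale p (mod-unscale p (subst (p * (p * (x₁ * x₁ + y₁ * y₁)) ≈_mod p * (p * p ^ k)) (m≡p²[m/p/p] p∣m p∣m/p) rep′)))
    non-sum⇒¬sum (suc (suc k)) m ns (x , y , rep) | yes p∣m | no p∤m/p with descend k p∣m (x , y , rep)
    ...   | x₁ , y₁ , rep′ = p∤m/p (*-cancelˡ-∣ p p²∣p[m/p])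
      where
      rearrange : ∀ p q → p * (p * q) ≡ q * (p * p)
      rearrange = solve-∀
      p²∣m : p * p ∣ m
      p²∣m = ∣-resp-mod (subst (p * p ∣_) (*-assoc p p (x₁ * x₁ + y₁ * y₁)) (m∣m*n (x₁ * x₁ + y₁ * y₁)))
                        (mod-divisor (p ^ k) (subst (p * (p * (x₁ * x₁ + y₁ * y₁)) ≈ m mod_) (rearrange p (p ^ k)) rep′))
      p²∣p[m/p] : p * p ∣ p * (m / p)
      p²∣p[m/p] = subst (p * p ∣_) (trans (sym (m/n*n≡m p∣m)) (*-comm (m / p) p)) p²∣m

    -- Conversely, if non-sum k m fails then m is a sum of two squares mod p^k: units by
    -- Hensel lifting, multiples of p^k trivially, and m = p²·m′ by scaling a representation of m′.
    ¬non-sum⇒sum : ∀ k m → non-sum k m ≡ false → SumOfTwoSquares (p ^ k) m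
    ¬non-sum⇒sum zero m _ = 0 , 0 , mod-one 0 m
    ¬non-sum⇒sum (suc zero) m _ with p ∣? m
    ... | yes p∣m = 0 , 0 , mod-sym (subst (m ≈ 0 mod_) (sym (*-identityʳ p)) (∣⇒mod-0 p∣m))
    ... | no  p∤m = unit-is-two-squares 1 m p∤m
    ¬non-sum⇒sum (suc (suc k)) m ns with p ∣? m | p ∣? (m / p)
    ¬non-sum⇒sum (suc (suc k)) m _  | no  p∤m | _ = unit-is-two-squares (suc (suc k)) m p∤m
    ¬non-sum⇒sum (suc (suc k)) m () | yes _   | no _
    ¬non-sum⇒sum (suc (suc k)) m ns | yes p∣m | yes p∣m/p with ¬non-sum⇒sum k (m / p / p) ns
    ... | x , y , rep = p * x , p * y ,
      subst₂ (_≈_mod p * (p * p ^ k)) (distribute p x y) (sym (m≡p²[m/p/p] p∣m p∣m/p))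
             (mod-scale p (mod-scale p rep))
      where
      distribute : ∀ p x y → p * (p * (x * x + y * y)) ≡ p * x * (p * x) + p * y * (p * y)
      distribute = solve-∀

    non-sum-unit : ∀ k {m} → ¬ p ∣ m → non-sum (suc (suc k)) m ≡ false
    non-sum-unit k {m} p∤m with p ∣? m
    ... | yes p∣m = ⊥-elim (p∤m p∣m)
    ... | no  _   = refl

    non-sum-odd : ∀ k {m} → p ∣ m → ¬ p ∣ m / p → non-sum (suc (suc k)) m ≡ true
    non-sum-odd k {m} p∣m p∤m/p with p ∣? m | p ∣? (m / p)
    ... | no  p∤m | _         = ⊥-elim (p∤m p∣m)
    ... | yes _   | yes p∣m/p = ⊥-elim (p∤m/p p∣m/p)
    ... | yes _   | no  _     = refl

    non-sum-strip : ∀ k {m} → p ∣ m → p ∣ m / p → non-sum (suc (suc k)) m ≡ non-sum k (m / p / p)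
    non-sum-strip k {m} p∣m p∣m/p with p ∣? m | p ∣? (m / p)
    ... | no  p∤m | _         = ⊥-elim (p∤m p∣m)
    ... | yes _   | no  p∤m/p = ⊥-elim (p∤m/p p∣m/p)
    ... | yes _   | yes _     = refl

    [ap+r]/p≡a : ∀ a {r} → r < p → (a * p + r) / p ≡ a
    [ap+r]/p≡a a {r} r<p = begin
      (a * p + r) / p     ≡⟨ cong (_/ p) (+-comm (a * p) r) ⟩
      (r + a * p) / p     ≡⟨ +-distrib-/-∣ʳ r (n∣m*n a) ⟩
      r / p + a * p / p   ≡⟨ cong₂ _+_ (m<n⇒m/n≡0 r<p) (m*n/n≡m a p) ⟩
      a                   ∎
      where open ≡-Reasoning

    p∤ap+r : ∀ a {r} → 0 < r → r < p → ¬ p ∣ a * p + r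
    p∤ap+r a 0<r r<p p∣ap+r = p∤small 0<r r<p (∣m+n∣m⇒∣n p∣ap+r (n∣m*n a))

    block-of-units : ∀ k a → sumTo p (λ r → indicator (non-sum (suc (suc k)) (a * p + r)))
                             ≡ indicator (non-sum (suc (suc k)) (a * p))
    block-of-units k a = begin
      indicator (non-sum (suc (suc k)) (a * p + 0)) + sumTo p-1 (λ r → indicator (non-sum (suc (suc k)) (a * p + suc r)))
        ≡⟨ cong₂ (λ m u → indicator (non-sum (suc (suc k)) m) + u) (+-identityʳ (a * p)) units-vanish ⟩
      indicator (non-sum (suc (suc k)) (a * p)) + 0
        ≡⟨ +-identityʳ _ ⟩
      indicator (non-sum (suc (suc k)) (a * p))
        ∎
      where
      open ≡-Reasoning
      units-vanish : sumTo p-1 (λ r → indicator (non-sum (suc (suc k)) (a * p + suc r))) ≡ 0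
      units-vanish = trans (sumTo-cong p-1 (λ r r<p-1 → cong indicator (non-sum-unit k (p∤ap+r a z<s (s<s r<p-1)))))
                           (trans (sumTo-const p-1 0) (*-zeroʳ p-1))

    -- |N| among the multiples (b·p + r)·p, r < p: r = 0 contributes [non-sum k b], and each
    -- of the p - 1 others has p-multiplicity exactly one.
    block-of-multiples : ∀ k b → sumTo p (λ r → indicator (non-sum (suc (suc k)) ((b * p + r) * p)))
                                 ≡ indicator (non-sum k b) + p-1
    block-of-multiples k b = cong₂ _+_ (cong indicator stripped) (trans (sumTo-cong p-1 odd) (trans (sumTo-const p-1 1) (*-identityʳ p-1)))
      where
      [m*p]/p≡m : ∀ m → m * p / p ≡ m
      [m*p]/p≡m m = m*n/n≡m m p
      stripped : non-sum (suc (suc k)) ((b * p + 0) * p) ≡ non-sum k b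
      stripped = trans (non-sum-strip k (n∣m*n (b * p + 0)) (subst (p ∣_) (sym ([m*p]/p≡m (b * p + 0))) (∣m∣n⇒∣m+n (n∣m*n b) (p ∣0))))
                       (cong (non-sum k) (trans (cong (_/ p) ([m*p]/p≡m (b * p + 0))) ([ap+r]/p≡a b z<s)))
      odd : ∀ r → r < p-1 → indicator (non-sum (suc (suc k)) ((b * p + suc r) * p)) ≡ 1
      odd r r<p-1 = cong indicator (non-sum-odd k (n∣m*n (b * p + suc r))
                      (λ p∣m/p → p∤ap+r b z<s (s<s r<p-1) (subst (p ∣_) ([m*p]/p≡m (b * p + suc r)) p∣m/p)))

    count : ℕ → ℕ
    count k = sumTo (p ^ k) (indicator ∘ non-sum k)

    cardN≡count : ∀ k .{{_ : NonZero (p ^ k)}} → cardN (p ^ k) ≡ count k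
    cardN≡count k = length-filter-tabulate (λ m → ¬? (InS? (p ^ k) m)) (p ^ k) id (non-sum k) decides
      where
      decides : ∀ i → does (¬? (InS? (p ^ k) i)) ≡ non-sum k (toℕ i)
      decides i with non-sum k (toℕ i) in eq | InS? (p ^ k) i
      ... | true  | yes s  = ⊥-elim (non-sum⇒¬sum k (toℕ i) eq (InS⇒sum (p ^ k) i s))
      ... | true  | no  _  = refl
      ... | false | yes _  = refl
      ... | false | no  ¬s = ⊥-elim (¬s (sum⇒InS (p ^ k) i (¬non-sum⇒sum k (toℕ i) eq)))

    -- Splitting [0, p^(k+2)) into blocks of length p twice: count(k+2) = count(k) + p^k (p - 1).
    count-recurrence : ∀ k → count (suc (suc k)) ≡ count k + p ^ k * p-1
    count-recurrence k = begin
      sumTo (p * (p * p ^ k)) F                                   ≡⟨ cong (λ n → sumTo n F) (rearrange p (p ^ k)) ⟩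
      sumTo (p ^ k * p * p) F                                     ≡⟨ sumTo-blocks (p ^ k * p) p F ⟩
      sumTo (p ^ k * p) (λ a → sumTo p (λ r → F (a * p + r)))     ≡⟨ sumTo-cong (p ^ k * p) (λ a _ → block-of-units k a) ⟩
      sumTo (p ^ k * p) (λ a → F (a * p))                         ≡⟨ sumTo-blocks (p ^ k) p (λ a → F (a * p)) ⟩
      sumTo (p ^ k) (λ b → sumTo p (λ r → F ((b * p + r) * p)))   ≡⟨ sumTo-cong (p ^ k) (λ b _ → block-of-multiples k b) ⟩
      sumTo (p ^ k) (λ b → indicator (non-sum k b) + p-1)         ≡⟨ sumTo-+ (p ^ k) (indicator ∘ non-sum k) (λ _ → p-1) ⟩
      count k + sumTo (p ^ k) (λ _ → p-1)                         ≡⟨ cong (count k +_) (sumTo-const (p ^ k) p-1) ⟩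
      count k + p ^ k * p-1                                       ∎
      where
      open ≡-Reasoning
      F = indicator ∘ non-sum (suc (suc k))
      rearrange : ∀ p q → p * (p * q) ≡ q * p * p
      rearrange = solve-∀

    count-step : ∀ k r → count k * suc p + r ≡ p ^ k → count (suc (suc k)) * suc p + r ≡ p ^ suc (suc k)
    count-step k r hyp = begin
      count (suc (suc k)) * suc p + r              ≡⟨ cong (λ c → c * suc p + r) (count-recurrence k) ⟩
      (count k + p ^ k * p-1) * suc p + r          ≡⟨ regroup (count k) (p ^ k) p-1 r ⟩
      p ^ k * p-1 * suc p + (count k * suc p + r)  ≡⟨ cong (p ^ k * p-1 * suc p +_) hyp ⟩
      p ^ k * p-1 * suc p + p ^ k                  ≡⟨ collect (p ^ k) p-1 ⟩
      p * (p * p ^ k)                              ∎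
      where
      open ≡-Reasoning
      regroup : ∀ c P n r → (c + P * n) * suc (suc n) + r ≡ P * n * suc (suc n) + (c * suc (suc n) + r)
      regroup = solve-∀
      collect : ∀ P n → P * n * suc (suc n) + P ≡ suc n * (suc n * P)
      collect = solve-∀

    count-even : ∀ i → count (i + i) * suc p + 1 ≡ p ^ (i + i)
    count-even zero    = refl
    count-even (suc i) = subst (λ e → count e * suc p + 1 ≡ p ^ e) (sym (+-suc (suc i) i))
                               (count-step (i + i) 1 (count-even i))

    count-odd : ∀ i → count (suc (i + i)) * suc p + p ≡ p ^ suc (i + i)
    count-odd zero    = begin
      count 1 * suc p + p   ≡⟨ cong (λ c → c * suc p + p) (sumTo-const (p * 1) 0) ⟩
      p * 1 * 0 * suc p + p ≡⟨ cong (λ c → c * suc p + p) (*-zeroʳ (p * 1)) ⟩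
      p                     ≡⟨ *-identityʳ p ⟨
      p * 1                 ∎
      where open ≡-Reasoning
    count-odd (suc i) = subst (λ e → count (suc e) * suc p + p ≡ p ^ suc e) (sym (+-suc (suc i) i))
                              (count-step (suc (i + i)) p (count-odd i))

    count-even-exponent : ∀ k → k % 2 ≡ 0 → count k ≡ (p ^ k ∸ 1) / suc p
    count-even-exponent k k%2≡0 = subst (λ e → count e ≡ (p ^ e ∸ 1) / suc p) (sym (even⇒double k k%2≡0)) (begin
      count (i + i)                               ≡⟨ exact-quotient (count (i + i)) (suc p) 1 ⟨
      (count (i + i) * suc p + 1 ∸ 1) / suc p     ≡⟨ cong (λ n → (n ∸ 1) / suc p) (count-even i) ⟩
      (p ^ (i + i) ∸ 1) / suc p                   ∎)
      where
      open ≡-Reasoning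
      i = k / 2

    count-odd-exponent : ∀ k → k % 2 ≡ 1 → count k ≡ (p ^ k ∸ p) / suc p
    count-odd-exponent k k%2≡1 = subst (λ e → count e ≡ (p ^ e ∸ p) / suc p) (sym (odd⇒double+1 k k%2≡1)) (begin
      count (suc (i + i))                             ≡⟨ exact-quotient (count (suc (i + i))) (suc p) p ⟨
      (count (suc (i + i)) * suc p + p ∸ p) / suc p   ≡⟨ cong (λ n → (n ∸ p) / suc p) (count-odd i) ⟩
      (p ^ suc (i + i) ∸ p) / suc p                   ∎)
      where
      open ≡-Reasoning
      i = k / 2

-- |N_{p^k}| = (p^k - 1)/(p + 1) for even k and (p^k - p)/(p + 1) for odd k, when p ≡ 3 mod 4
-- (the argument does not need k ≥ 1).
corollary2 : (p k : ℕ) → .{{_ : NonZero p}} → Prime p → p % 4 ≡ 3 → k ≥ 1 →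
    let instance _ = m^n≢0 p k in
    (k % 2 ≡ 0 → cardN (p ^ k) ≡ (p ^ k ∸ 1) / suc p)
    × (k % 2 ≡ 1 → cardN (p ^ k) ≡ (p ^ k ∸ p) / suc p)
corollary2 (suc p-1) k p-prime p%4≡3 _ =
  (λ k%2≡0 → trans (cardN≡count p-1 p-prime p%4≡3 k) (count-even-exponent p-1 p-prime p%4≡3 k k%2≡0)) ,
  (λ k%2≡1 → trans (cardN≡count p-1 p-prime p%4≡3 k) (count-odd-exponent p-1 p-prime p%4≡3 k k%2≡1))
  where instance _ = m^n≢0 (suc p-1) k
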